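{- Let $G$ be a graph and $M$ a module of $G$. Then $D(G)\geq D(M)$, where $D(M)$ denotes the distinguishing number of the subgraph of $G$ induced by $M$.
   Context: All graphs are finite, simple, loopless and undirected. A module of a graph $G=(V,E)$ is a subset $M\subseteq V$ such that for every $y\in V\setminus M$, either $y$ is adjacent to every vertex of $M$ or $y$ is adjacent to no vertex of $M$. For a graph $H$, an $r$-labeling $c:V(H)\to\{1,\dots,r\}$ is $r$-distinguishing if for every automorphism $\sigma\neq \mathrm{id}$ of $H$ we have $c\neq c\circ\sigma$; the distinguishing number $D(H)$ is the smallest $r$ such that $H$ has an $r$-distinguishing labeling. -}

module Defs where

open import Data.Nat using (ℕ)
open import Data.Fin using (Fin)
open import Data.Bool using (Bool; true; false; T)
open import Data.Product using (Σ; _×_; _,_; proj₁)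
open import Data.Sum using (_⊎_)
open import Data.Empty using (⊥)
open import Relation.Nullary using (¬_)
open import Relation.Binary.PropositionalEquality using (_≡_)
open import Function.Bundles using (_↔_; Inverse)

record Graph (V : Set) : Set where
  field
    adj   : V → V → Bool
    sym   : ∀ x y → adj x y ≡ adj y x
    loopless : ∀ x → adj x x ≡ false
open Graph public

FinGraph : ℕ → Set
FinGraph n = Graph (Fin n)

record Automorphism {V : Set} (H : Graph V) : Set where
  field
    perm     : V ↔ V
    preserve : ∀ x y → adj H (Inverse.to perm x) (Inverse.to perm y) ≡ adj H x y
open Automorphism public

IsIdentity : {V : Set} {H : Graph V} → Automorphism H → Set
IsIdentity σ = ∀ x → Inverse.to (perm σ) x ≡ x

IsDistinguishing : {V : Set} (H : Graph V) (r : ℕ) → (V → Fin r) → Set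
IsDistinguishing H r c =
  (σ : Automorphism H) → ¬ IsIdentity σ → ¬ (∀ x → c x ≡ c (Inverse.to (perm σ) x))

HasDistinguishingLabeling : {V : Set} → Graph V → ℕ → Set
HasDistinguishingLabeling {V} H r = Σ (V → Fin r) (IsDistinguishing H r)

IsDistinguishingNumber : {V : Set} → Graph V → ℕ → Set
IsDistinguishingNumber H d =
  HasDistinguishingLabeling H d × (∀ r → HasDistinguishingLabeling H r → d Data.Nat.≤ r)

VSubset : ℕ → Set
VSubset n = Fin n → Bool

IsModule : {n : ℕ} → FinGraph n → VSubset n → Set
IsModule {n} G M = (y : Fin n) → ¬ T (M y) →
  ((x : Fin n) → T (M x) → adj G y x ≡ true) ⊎ ((x : Fin n) → T (M x) → adj G y x ≡ false)

Induced : {n : ℕ} → (G : FinGraph n) → (M : VSubset n) → Graph (Σ (Fin n) (λ i → T (M i)))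
Induced G M = record
  { adj = λ x y → adj G (proj₁ x) (proj₁ y)
  ; sym = λ x y → sym G (proj₁ x) (proj₁ y)
  ; loopless = λ x → loopless G (proj₁ x)
  }

-- An automorphism τ of G[M] extends to an automorphism of G by fixing every vertex
-- outside M: since M is a module, a vertex y ∉ M sees x and τ x alike.  A nontrivial
-- τ has a nontrivial extension, which agrees with τ on M, so the restriction to M of a
-- distinguishing labeling of G is distinguishing for G[M].
module Submission where

open import Defs
open import Data.Nat using (ℕ; _≤_)
open import Data.Fin using (Fin)
open import Data.Bool using (Bool; T)
open import Data.Bool.Properties using (T-irrelevant)
open import Data.Product using (Σ; _,_; proj₁; proj₂)
open import Data.Sum using (inj₁; inj₂)
open import Data.Empty using (⊥-elim)
open import Relation.Nullary using (¬_; yes; no)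
open import Relation.Nullary.Decidable.Core using (T?)
open import Relation.Binary.PropositionalEquality
  using (_≡_; refl; trans; cong) renaming (sym to ≡-sym)
open import Function.Bundles using (_↔_; Inverse; mk↔ₛ′)

module ExtendByIdentity {V : Set} (P : V → Bool) where

  Sub : Set
  Sub = Σ V (λ v → T (P v))

  Sub-≡ : ∀ {u v} (p : T (P u)) (q : T (P v)) → u ≡ v → _≡_ {A = Sub} (u , p) (v , q)
  Sub-≡ p q refl rewrite T-irrelevant p q = refl

  extend : (Sub → Sub) → V → V
  extend f v with T? (P v)
  ... | yes p = proj₁ (f (v , p))
  ... | no _  = v

  extend-inside : ∀ f v (p : T (P v)) → extend f v ≡ proj₁ (f (v , p))
  extend-inside f v p with T? (P v)
  ... | yes q rewrite T-irrelevant p q = refl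
  ... | no ¬q = ⊥-elim (¬q p)

  extend-outside : ∀ f v → ¬ T (P v) → extend f v ≡ v
  extend-outside f v ¬p with T? (P v)
  ... | yes p = ⊥-elim (¬p p)
  ... | no _  = refl

  extend-inverse : (f g : Sub → Sub) → (∀ s → f (g s) ≡ s) → ∀ v → extend f (extend g v) ≡ v
  extend-inverse f g f∘g≗id v with T? (P v)
  ... | no ¬p = extend-outside f v ¬p
  ... | yes p = trans (extend-inside f _ (proj₂ (g (v , p)))) (cong proj₁ (f∘g≗id (v , p)))

  extend-↔ : Sub ↔ Sub → V ↔ V
  extend-↔ π = mk↔ₛ′ (extend to) (extend from)
    (extend-inverse to from (Inverse.strictlyInverseˡ π))
    (extend-inverse from to (Inverse.strictlyInverseʳ π))
    where open Inverse π using (to; from)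

  extend-≉id : ∀ f → ¬ (∀ s → f s ≡ s) → ¬ (∀ v → extend f v ≡ v)
  extend-≉id f f≉id extend≗id = f≉id λ { (v , p) →
    ≡-sym (Sub-≡ p (proj₂ (f (v , p))) (trans (≡-sym (extend≗id v)) (extend-inside f v p))) }

module _ {n : ℕ} (G : FinGraph n) (M : VSubset n) (M-module : IsModule G M) where
  open ExtendByIdentity M

  module-adj-uniform : ∀ y → ¬ T (M y) → ∀ a b → T (M a) → T (M b) → adj G y a ≡ adj G y b
  module-adj-uniform y y∉M a b a∈M b∈M with M-module y y∉M
  ... | inj₁ all = trans (all a a∈M) (≡-sym (all b b∈M))
  ... | inj₂ none = trans (none a a∈M) (≡-sym (none b b∈M))

  extend-automorphism : Automorphism (Induced G M) → Automorphism G
  extend-automorphism τ = record { perm = extend-↔ (perm τ) ; preserve = preserves }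
    where
      t = Inverse.to (perm τ)
      preserves : ∀ x y → adj G (extend t x) (extend t y) ≡ adj G x y
      preserves x y with T? (M x) | T? (M y)
      ... | yes x∈M | yes y∈M = preserve τ (x , x∈M) (y , y∈M)
      ... | yes x∈M | no  y∉M =
        trans (Graph.sym G _ y)
          (trans (module-adj-uniform y y∉M _ x (proj₂ (t (x , x∈M))) x∈M) (Graph.sym G y x))
      ... | no  x∉M | yes y∈M = module-adj-uniform x x∉M _ y (proj₂ (t (y , y∈M))) y∈M
      ... | no  _   | no  _   = refl

  restrict-distinguishing : ∀ r (c : Fin n → Fin r) → IsDistinguishing G r c →
    IsDistinguishing (Induced G M) r (λ s → c (proj₁ s))
  restrict-distinguishing r c c-dist τ τ≉id c-fixed =
    c-dist (extend-automorphism τ) (extend-≉id t τ≉id) extension-fixes-c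
    where
      t = Inverse.to (perm τ)
      extension-fixes-c : ∀ x → c x ≡ c (extend t x)
      extension-fixes-c x with T? (M x)
      ... | yes x∈M = c-fixed (x , x∈M)
      ... | no  _   = refl

lemma1 : (n : ℕ) (G : FinGraph n) (M : VSubset n) → IsModule G M →
    (dG dM : ℕ) → IsDistinguishingNumber G dG → IsDistinguishingNumber (Induced G M) dM →
    dM ≤ dG
lemma1 n G M M-module dG dM ((c , c-dist) , _) (_ , dM-minimal) =
  dM-minimal dG ((λ s → c (proj₁ s)) , restrict-distinguishing G M M-module dG c c-dist)
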